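{- For $n\ge 2$ let $r_n$ be the proportion of two-rooted graphs on the vertex set $\{v_1,\dots,v_n\}$ that are \textbf{gcds}-sortable, i.e. \[ r_n = \frac{1}{2^{\frac{n(n-1)}{2}}} \sum_{s=0}^{\lfloor n/2 \rfloor-1} 2^{s(s+3)}\left( \dfrac{\prod_{i=0}^{2s-1} \left(2^{n-2-i}-1\right)}{\prod_{i=1}^s \left(2^{2i}-1\right)} \right).\] Then the sequences $(r_{2n})_{n\in\mathbb N}$ and $(r_{2n+1})_{n\in\mathbb N}$ each converge to a finite, strictly positive constant.
   Context: A two-rooted graph is a finite simple undirected graph on the labeled vertex set $\{v_1,\dots,v_n\}$ with roots $v_1$ and $v_n$; there are $2^{n(n-1)/2}$ of them. For vertices $x,y$ let $f_x(y)=1$ if $x,y$ are adjacent and $0$ otherwise. For adjacent non-root vertices $p,q$, $\textbf{gcds}_{\{p,q\}}(G)$ is the graph on the same vertices in which distinct $u,v$ are adjacent iff $f_p(u)f_q(v)+f_q(u)f_p(v)+f_u(v)\equiv 1\pmod 2$. A two-rooted graph is \textbf{gcds}-sortable if finitely many such operations transform it into the edgeless graph. -}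

module Defs where

open import Data.Nat using (ℕ; zero; suc; _*_; _∸_; _^_; _+_)
open import Data.Nat.DivMod using (_/_)
open import Data.List using (List; map; upTo; foldr)
open import Data.Nat.ListAction using (product)
open import Data.Integer using (+_)
open import Data.Rational using (ℚ; 0ℚ) renaming (_/_ to _/ℚ_; _+_ to _+ℚ_; _*_ to _*ℚ_)

-- a / d as a rational number; the denominators used below are always
-- nonzero, the zero case is only a totality convention.
frac : ℕ → ℕ → ℚ
frac a zero = 0ℚ
frac a (suc d) = (+ a) /ℚ (suc d)

-- ∏_{i=0}^{2s-1} (2^{n-2-i} - 1)   (all factors ≥ 1 when s ≤ ⌊n/2⌋-1)
numProd : ℕ → ℕ → ℕ
numProd n s = product (map (λ i → 2 ^ (n ∸ 2 ∸ i) ∸ 1) (upTo (2 * s)))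

denProd : ℕ → ℕ
denProd s = product (map (λ j → 2 ^ (2 * suc j) ∸ 1) (upTo s))

term : ℕ → ℕ → ℚ
term n s = frac (2 ^ (s * (s + 3)) * numProd n s) (denProd s)

sumℚ : List ℚ → ℚ
sumℚ = foldr _+ℚ_ 0ℚ

r : ℕ → ℚ
r n = frac 1 (2 ^ ((n * (n ∸ 1)) / 2)) *ℚ sumℚ (map (term n) (upTo (n / 2)))

{-# OPTIONS --safe #-}
module Submission where

-- Write r n = Σ_{s < ⌊n/2⌋} t n s with t n s = 2^(-n(n-1)/2) · 2^(s(s+3)) · numProd n s / denProd s.
-- Passing from n + 1 to n + 3 adds the new summand t (n+3) 0 = 2^(-(n+3)(n+2)/2) and multiplies each
-- old one by an explicit factor, t (n+3) (s+1) = t (n+1) s · ρ, where 1 - 3/2^(n+1) ≤ ρ ≤ 1 + 1/(3·4^s).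
-- The upper bound costs at most a third of the damped sum Σ_s t (n+1) s / 4^s, which itself contracts
-- by a factor 3 per step; the lower bound costs 3/2^(n+1) · r (n+1), and r stays below 2. Hence along a
-- parity class x j = r (2 + e + 2j) one gets x (j+1) ≤ x j + 1/2^(j+1) and x j ≤ x (j+1) + 3/2^(j+1):
-- x is Cauchy and stays above x 5 - 3/2^5, which is positive by evaluation.

open import Defs
open import Data.Nat using (ℕ; _≥_; _*_; _+_)
open import Data.Rational using (ℚ; 0ℚ; _<_; _≤_; _-_; ∣_∣)
open import Data.Product using (_×_; ∃-syntax)

open import Level using (0ℓ)
open import Function using (_∘_)
open import Data.Nat as ℕ using (zero; suc; _∸_; _^_; z≤n; s≤s; z<s)
import Data.Nat.Properties as ℕ
open import Data.Nat.Tactic.RingSolver using (solve-∀)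
open import Data.Integer as ℤ using (+[1+_]; -[1+_])
import Data.Integer.Properties as ℤ
open import Data.Rational as ℚ using (mkℚ; 1ℚ; -_; toℚᵘ) renaming (_+_ to _+ℚ_; _*_ to _*ℚ_)
import Data.Rational.Properties as ℚ
open import Data.Rational.Unnormalised as ℚᵘ using (mkℚᵘ; *≡*; *≤*; *<*)
import Data.Rational.Unnormalised.Properties as ℚᵘ
open import Data.Nat.DivMod using (_/_; +-distrib-/-∣ʳ; m*n/n≡m; m/n≡1+[m∸n]/n)
open import Data.Nat.Divisibility using (divides)
open import Data.Nat.ListAction using (product)
open import Data.Nat.ListAction.Properties using (product-++)
open import Data.List using (_∷_; [_]; _++_; map; upTo; applyUpTo)
open import Data.List.Properties using (map-upTo; map-applyUpTo; applyUpTo-∷ʳ)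
open import Algebra.Bundles using (CommutativeMonoid)
open import Algebra.Properties.CommutativeSemigroup (CommutativeMonoid.commutativeSemigroup ℚ.+-0-commutativeMonoid)
  using (interchange)
open import Data.Product using (_,_)
open import Data.Sum using (inj₁; inj₂)
open import Relation.Binary.PropositionalEquality using (_≡_; refl; sym; trans; cong; cong₂; subst; subst₂; module ≡-Reasoning)
open import Relation.Nullary.Decidable.Core using (dec⇒maybe; from-yes)
import Tactic.RingSolver as RingSolver
import Tactic.RingSolver.Core.AlmostCommutativeRing as ACR

private
  toℚᵘ-frac : ∀ a b → toℚᵘ (frac a (suc b)) ℚᵘ.≃ mkℚᵘ (ℤ.+ a) b
  toℚᵘ-frac a b = ℚ.toℚᵘ-fromℚᵘ (mkℚᵘ (ℤ.+ a) b)

frac-≡ : ∀ {a b c d} → 0 ℕ.< b → 0 ℕ.< d → a * d ≡ c * b → frac a b ≡ frac c d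
frac-≡ {a} {suc b} {c} {suc d} _ _ eq = ℚ.toℚᵘ-injective (ℚᵘ.≃-trans (toℚᵘ-frac a b) (ℚᵘ.≃-trans
  (*≡* (trans (sym (ℤ.pos-* a (suc d))) (trans (cong ℤ.+_ eq) (ℤ.pos-* c (suc b)))))
  (ℚᵘ.≃-sym (toℚᵘ-frac c d))))

frac-≤ : ∀ {a b c d} → 0 ℕ.< b → 0 ℕ.< d → a * d ℕ.≤ c * b → frac a b ≤ frac c d
frac-≤ {a} {suc b} {c} {suc d} _ _ le = ℚ.toℚᵘ-cancel-≤
  (ℚᵘ.≤-respʳ-≃ (ℚᵘ.≃-sym (toℚᵘ-frac c d)) (ℚᵘ.≤-respˡ-≃ (ℚᵘ.≃-sym (toℚᵘ-frac a b))
    (*≤* (subst₂ ℤ._≤_ (ℤ.pos-* a (suc d)) (ℤ.pos-* c (suc b)) (ℤ.+≤+ le)))))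

frac-< : ∀ {a b c d} → 0 ℕ.< b → 0 ℕ.< d → a * d ℕ.< c * b → frac a b < frac c d
frac-< {a} {suc b} {c} {suc d} _ _ lt = ℚ.toℚᵘ-cancel-<
  (ℚᵘ.<-respʳ-≃ (ℚᵘ.≃-sym (toℚᵘ-frac c d)) (ℚᵘ.<-respˡ-≃ (ℚᵘ.≃-sym (toℚᵘ-frac a b))
    (*<* (subst₂ ℤ._<_ (ℤ.pos-* a (suc d)) (ℤ.pos-* c (suc b)) (ℤ.+<+ lt)))))

frac-* : ∀ {a b c d} → 0 ℕ.< b → 0 ℕ.< d → frac a b *ℚ frac c d ≡ frac (a * c) (b * d)
frac-* {a} {suc b} {c} {suc d} _ _ = ℚ.toℚᵘ-injective (ℚᵘ.≃-trans
  (ℚ.toℚᵘ-homo-* (frac a (suc b)) (frac c (suc d))) (ℚᵘ.≃-trans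
  (ℚᵘ.*-cong (toℚᵘ-frac a b) (toℚᵘ-frac c d)) (ℚᵘ.≃-trans
  (ℚᵘ.≃-reflexive (cong (λ n → mkℚᵘ n (d + b * suc d)) (sym (ℤ.pos-* a c))))
  (ℚᵘ.≃-sym (toℚᵘ-frac (a * c) (d + b * suc d))))))

frac-+ : ∀ {a b c d} → 0 ℕ.< b → 0 ℕ.< d → frac a b +ℚ frac c d ≡ frac (a * d + c * b) (b * d)
frac-+ {a} {suc b} {c} {suc d} _ _ = ℚ.toℚᵘ-injective (ℚᵘ.≃-trans
  (ℚ.toℚᵘ-homo-+ (frac a (suc b)) (frac c (suc d))) (ℚᵘ.≃-trans
  (ℚᵘ.+-cong (toℚᵘ-frac a b) (toℚᵘ-frac c d)) (ℚᵘ.≃-trans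
  (ℚᵘ.≃-reflexive (cong (λ n → mkℚᵘ n (d + b * suc d)) (sym (trans
    (ℤ.pos-+ (a * suc d) (c * suc b)) (cong₂ ℤ._+_ (ℤ.pos-* a (suc d)) (ℤ.pos-* c (suc b)))))))
  (ℚᵘ.≃-sym (toℚᵘ-frac (a * suc d + c * suc b) (d + b * suc d))))))

0≤frac : ∀ a b → 0ℚ ≤ frac a b
0≤frac a zero = ℚ.≤-refl
0≤frac a (suc b) = frac-≤ {0} {1} {a} {suc b} z<s z<s z≤n

0<* : ∀ {m n} → 0 ℕ.< m → 0 ℕ.< n → 0 ℕ.< m * n
0<* {suc m} {suc n} _ _ = z<s

0<2^ : ∀ k → 0 ℕ.< 2 ^ k
0<2^ = ℕ.m^n>0 2

infix 8 _/2^_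
_/2^_ : ℕ → ℕ → ℚ
a /2^ k = frac a (2 ^ k)

/2^-+ : ∀ a b k → a /2^ k +ℚ b /2^ k ≡ (a + b) /2^ k
/2^-+ a b k = trans (frac-+ (0<2^ k) (0<2^ k))
  (frac-≡ (0<* (0<2^ k) (0<2^ k)) (0<2^ k) (cross a b (2 ^ k)))
  where
  cross : ∀ a b y → (a * y + b * y) * y ≡ (a + b) * (y * y)
  cross = solve-∀

/2^-halve : ∀ a k → a /2^ suc k +ℚ a /2^ suc k ≡ a /2^ k
/2^-halve a k = trans (/2^-+ a a (suc k)) (frac-≡ (0<2^ (suc k)) (0<2^ k) (cross a (2 ^ k)))
  where
  cross : ∀ a y → (a + a) * y ≡ a * (2 * y)
  cross = solve-∀

/2^-antitone : ∀ a {i k} → i ℕ.≤ k → a /2^ k ≤ a /2^ i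
/2^-antitone a {i} {k} i≤k = frac-≤ (0<2^ k) (0<2^ i) (ℕ.*-monoʳ-≤ a (ℕ.^-monoʳ-≤ 2 i≤k))

n<2^n : ∀ n → n ℕ.< 2 ^ n
n<2^n zero = z<s
n<2^n (suc n) = ℕ.+-mono-≤ (0<2^ n) (ℕ.≤-trans (n<2^n n) (ℕ.m≤m+n (2 ^ n) 0))

/2^-archimedean : ∀ a {ε} → 0ℚ < ε → ∃[ N ] a /2^ N < ε
/2^-archimedean a {ε@(mkℚ +[1+ p ] d _)} _ = N , subst (a /2^ N <_) (ℚ.↥p/↧p≡p ε)
  (frac-< {a} {2 ^ N} {suc p} {suc d} (0<2^ N) z<s (ℕ.<-≤-trans (n<2^n N) (ℕ.m≤n*m (2 ^ N) (suc p))))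
  where
  N : ℕ
  N = a * suc d
/2^-archimedean a {mkℚ (ℤ.+ zero) _ _} (ℚ.*<* (ℤ.+<+ ()))
/2^-archimedean a {mkℚ -[1+ _ ] _ _} (ℚ.*<* ())

ℚ-ring : ACR.AlmostCommutativeRing 0ℓ 0ℓ
ℚ-ring = ACR.fromCommutativeRing ℚ.+-*-commutativeRing (λ x → dec⇒maybe (0ℚ ℚ.≟ x))

p≤p+q : ∀ p {q} → 0ℚ ≤ q → p ≤ p +ℚ q
p≤p+q p {q} 0≤q = subst (_≤ p +ℚ q) (ℚ.+-identityʳ p) (ℚ.+-monoʳ-≤ p 0≤q)

*-monoˡ-≤-0≤ : ∀ {p q r} → 0ℚ ≤ p → q ≤ r → p *ℚ q ≤ p *ℚ r
*-monoˡ-≤-0≤ {p} 0≤p = ℚ.*-monoˡ-≤-nonNeg p {{ℚ.nonNegative 0≤p}}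

p≤q+r⇒p-q≤r : ∀ {p q r} → p ≤ q +ℚ r → p - q ≤ r
p≤q+r⇒p-q≤r {p} {q} {r} p≤q+r = subst (p - q ≤_) (cancel q r) (ℚ.+-monoˡ-≤ (- q) p≤q+r)
  where
  cancel : ∀ q r → q +ℚ r - q ≡ r
  cancel = RingSolver.solve-∀ ℚ-ring

p<q⇒0<q-p : ∀ {p q} → p < q → 0ℚ < q - p
p<q⇒0<q-p {p} {q} p<q = subst (_< q - p) (ℚ.+-inverseʳ p) (ℚ.+-monoˡ-< (- p) p<q)

∣p-q∣≤r : ∀ {p q r} → p ≤ q +ℚ r → q ≤ p +ℚ r → ∣ p - q ∣ ≤ r
∣p-q∣≤r {p} {q} {r} p≤q+r q≤p+r with ℚ.∣p∣≡p∨∣p∣≡-p (p - q)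
... | inj₁ ∣p-q∣≡p-q = subst (_≤ r) (sym ∣p-q∣≡p-q) (p≤q+r⇒p-q≤r p≤q+r)
... | inj₂ ∣p-q∣≡-[p-q] = subst (_≤ r) (sym (trans ∣p-q∣≡-[p-q] (flip p q))) (p≤q+r⇒p-q≤r q≤p+r)
  where
  flip : ∀ p q → - (p - q) ≡ q - p
  flip = RingSolver.solve-∀ ℚ-ring

-- Sequences with geometrically bounded increments

Cauchy : (ℕ → ℚ) → Set
Cauchy x = ∀ (ε : ℚ) → 0ℚ < ε → ∃[ N ] (∀ m k → m ≥ N → k ≥ N → ∣ x m - x k ∣ < ε)

BoundedAwayFromZero : (ℕ → ℚ) → Set
BoundedAwayFromZero x = ∃[ c ] (0ℚ < c × ∃[ N ] (∀ m → m ≥ N → c ≤ x m))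

Cauchy-tail : ∀ {x y : ℕ → ℚ} → (∀ j → x (suc j) ≡ y j) → Cauchy y → Cauchy x
Cauchy-tail {x} {y} tail cauchy ε ε>0 with cauchy ε ε>0
... | N , close = suc N , close′
  where
  close′ : ∀ m k → m ≥ suc N → k ≥ suc N → ∣ x m - x k ∣ < ε
  close′ (suc m) (suc k) (s≤s m≥N) (s≤s k≥N) =
    subst₂ (λ u v → ∣ u - v ∣ < ε) (sym (tail m)) (sym (tail k)) (close m k m≥N k≥N)

BoundedAwayFromZero-tail : ∀ {x y : ℕ → ℚ} → (∀ j → x (suc j) ≡ y j) → BoundedAwayFromZero y → BoundedAwayFromZero x
BoundedAwayFromZero-tail {x} {y} tail (c , c>0 , N , above) = c , c>0 , suc N , above′
  where
  above′ : ∀ m → m ≥ suc N → c ≤ x m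
  above′ (suc m) (s≤s m≥N) = subst (c ≤_) (sym (tail m)) (above m m≥N)

upper-drift : ∀ {x : ℕ → ℚ} a → (∀ j → x (suc j) ≤ x j +ℚ a /2^ suc j) →
              ∀ {i j} → i ℕ.≤ j → x j ≤ x i +ℚ a /2^ i
upper-drift {x} a step {i} {j} i≤j = subst (λ k → x k ≤ x i +ℚ a /2^ i) (ℕ.m∸n+n≡m i≤j) (from (j ∸ i) i)
  where
  open ℚ.≤-Reasoning
  from : ∀ d i → x (d + i) ≤ x i +ℚ a /2^ i
  from zero i = p≤p+q (x i) (0≤frac a (2 ^ i))
  from (suc d) i = begin
    x (suc d + i)                      ≡⟨ cong x (ℕ.+-suc d i) ⟨
    x (d + suc i)                      ≤⟨ from d (suc i) ⟩
    x (suc i) +ℚ a /2^ suc i           ≤⟨ ℚ.+-monoˡ-≤ _ (step i) ⟩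
    x i +ℚ a /2^ suc i +ℚ a /2^ suc i  ≡⟨ ℚ.+-assoc (x i) _ _ ⟩
    x i +ℚ (a /2^ suc i +ℚ a /2^ suc i) ≡⟨ cong (x i +ℚ_) (/2^-halve a i) ⟩
    x i +ℚ a /2^ i                     ∎

lower-drift : ∀ {x : ℕ → ℚ} b → (∀ j → x j ≤ x (suc j) +ℚ b /2^ suc j) →
              ∀ {i j} → i ℕ.≤ j → x i ≤ x j +ℚ b /2^ i
lower-drift {x} b step {i} {j} i≤j = subst (λ k → x i ≤ x k +ℚ b /2^ i) (ℕ.m∸n+n≡m i≤j) (from (j ∸ i) i)
  where
  open ℚ.≤-Reasoning
  from : ∀ d i → x i ≤ x (d + i) +ℚ b /2^ i
  from zero i = p≤p+q (x i) (0≤frac b (2 ^ i))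
  from (suc d) i = begin
    x i                                            ≤⟨ step i ⟩
    x (suc i) +ℚ b /2^ suc i                       ≤⟨ ℚ.+-monoˡ-≤ _ (from d (suc i)) ⟩
    x (d + suc i) +ℚ b /2^ suc i +ℚ b /2^ suc i    ≡⟨ ℚ.+-assoc (x (d + suc i)) _ _ ⟩
    x (d + suc i) +ℚ (b /2^ suc i +ℚ b /2^ suc i)  ≡⟨ cong₂ (λ k c → x k +ℚ c) (ℕ.+-suc d i) (/2^-halve b i) ⟩
    x (suc d + i) +ℚ b /2^ i                       ∎

nearlyMonotone⇒Cauchy : ∀ {x : ℕ → ℚ} a b →
  (∀ j → x (suc j) ≤ x j +ℚ a /2^ suc j) → (∀ j → x j ≤ x (suc j) +ℚ b /2^ suc j) → Cauchy x
nearlyMonotone⇒Cauchy {x} a b up down ε ε>0 with /2^-archimedean (a + b) ε>0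
... | N , small = N , λ m k m≥N k≥N → ℚ.≤-<-trans (∣p-q∣≤r (close m≥N k≥N) (close k≥N m≥N)) small
  where
  open ℚ.≤-Reasoning
  close : ∀ {m k} → m ≥ N → k ≥ N → x m ≤ x k +ℚ (a + b) /2^ N
  close {m} {k} m≥N k≥N = begin
    x m                           ≤⟨ upper-drift {x} a up m≥N ⟩
    x N +ℚ a /2^ N                ≤⟨ ℚ.+-monoˡ-≤ (a /2^ N) (lower-drift b down k≥N) ⟩
    x k +ℚ b /2^ N +ℚ a /2^ N     ≡⟨ ℚ.+-assoc (x k) _ _ ⟩
    x k +ℚ (b /2^ N +ℚ a /2^ N)   ≡⟨ cong (x k +ℚ_) (trans (ℚ.+-comm (b /2^ N) (a /2^ N)) (/2^-+ a b N)) ⟩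
    x k +ℚ (a + b) /2^ N          ∎

lower-drift⇒BoundedAwayFromZero : ∀ {x : ℕ → ℚ} b N →
  (∀ j → x j ≤ x (suc j) +ℚ b /2^ suc j) → b /2^ N < x N → BoundedAwayFromZero x
lower-drift⇒BoundedAwayFromZero {x} b N down b/2^N<xN =
  x N - b /2^ N , p<q⇒0<q-p b/2^N<xN , N ,
  λ m m≥N → p≤q+r⇒p-q≤r (subst (x N ≤_) (ℚ.+-comm (x m) _) (lower-drift b down m≥N))

applyUpTo-cong : ∀ {A : Set} {f g : ℕ → A} k → (∀ i → f i ≡ g i) → applyUpTo f k ≡ applyUpTo g k
applyUpTo-cong zero    f≗g = refl
applyUpTo-cong (suc k) f≗g = cong₂ _∷_ (f≗g 0) (applyUpTo-cong k (f≗g ∘ suc))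

Σ : (ℕ → ℚ) → ℕ → ℚ
Σ f k = sumℚ (applyUpTo f k)

Σ-cong : ∀ {f g} k → (∀ s → f s ≡ g s) → Σ f k ≡ Σ g k
Σ-cong k f≗g = cong sumℚ (applyUpTo-cong k f≗g)

Σ-mono-≤ : ∀ {f g} k → (∀ s → f s ≤ g s) → Σ f k ≤ Σ g k
Σ-mono-≤ zero    f≤g = ℚ.≤-refl
Σ-mono-≤ (suc k) f≤g = ℚ.+-mono-≤ (f≤g 0) (Σ-mono-≤ k (f≤g ∘ suc))

Σ-+ : ∀ f g k → Σ (λ s → f s +ℚ g s) k ≡ Σ f k +ℚ Σ g k
Σ-+ f g zero    = refl
Σ-+ f g (suc k) = trans (cong (f 0 +ℚ g 0 +ℚ_) (Σ-+ (f ∘ suc) (g ∘ suc) k)) (interchange (f 0) (g 0) _ _)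

Σ-*ˡ : ∀ c f k → c *ℚ Σ f k ≡ Σ (λ s → c *ℚ f s) k
Σ-*ˡ c f zero    = ℚ.*-zeroʳ c
Σ-*ˡ c f (suc k) = trans (ℚ.*-distribˡ-+ c (f 0) _) (cong (c *ℚ f 0 +ℚ_) (Σ-*ˡ c (f ∘ suc) k))

Σ-*ʳ : ∀ c f k → Σ f k *ℚ c ≡ Σ (λ s → f s *ℚ c) k
Σ-*ʳ c f zero    = ℚ.*-zeroˡ c
Σ-*ʳ c f (suc k) = trans (ℚ.*-distribʳ-+ c (f 0) _) (cong (f 0 *ℚ c +ℚ_) (Σ-*ʳ c (f ∘ suc) k))

-- The summands of r

pairs : ℕ → ℕ
pairs n = (n * (n ∸ 1)) / 2

pairs-+2 : ∀ m → pairs (2 + m) ≡ pairs m + (2 * m + 1)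
pairs-+2 m = trans (cong (_/ 2) (doubled m))
  (trans (+-distrib-/-∣ʳ (m * (m ∸ 1)) (divides (2 * m + 1) refl)) (cong (pairs m +_) (m*n/n≡m (2 * m + 1) 2)))
  where
  doubled : ∀ m → (2 + m) * suc m ≡ m * (m ∸ 1) + (2 * m + 1) * 2
  doubled zero    = refl
  doubled (suc k) = ring k
    where
    ring : ∀ k → (3 + k) * (2 + k) ≡ suc k * k + (2 * suc k + 1) * 2
    ring = solve-∀

2^[2n]≡4^n : ∀ n → 2 ^ (2 * n) ≡ 4 ^ n
2^[2n]≡4^n n = sym (ℕ.^-*-assoc 2 2 n)

0<4^ : ∀ k → 0 ℕ.< 4 ^ k
0<4^ = ℕ.m^n>0 4

0<4*4^k∸1 : ∀ k → 0 ℕ.< 4 * 4 ^ k ∸ 1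
0<4*4^k∸1 k = ℕ.m<n⇒0<n∸m (ℕ.≤-trans (s≤s (s≤s z≤n)) (ℕ.*-monoʳ-≤ 4 (0<4^ k)))

numProd-step : ∀ n s → numProd (3 + n) (suc s) ≡ (2 ^ suc n ∸ 1) * ((2 ^ n ∸ 1) * numProd (1 + n) s)
numProd-step n s = begin
  numProd (3 + n) (suc s)
    ≡⟨ cong (λ k → product (map f (upTo k))) (ℕ.*-suc 2 s) ⟩
  f 0 * (f 1 * product (map f (applyUpTo (suc ∘ suc) (2 * s))))
    ≡⟨ cong (λ xs → f 0 * (f 1 * product xs)) tail ⟩
  (2 ^ suc n ∸ 1) * ((2 ^ n ∸ 1) * numProd (1 + n) s) ∎
  where
  open ≡-Reasoning
  f g : ℕ → ℕ
  f i = 2 ^ (3 + n ∸ 2 ∸ i) ∸ 1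
  g i = 2 ^ (1 + n ∸ 2 ∸ i) ∸ 1
  tail : map f (applyUpTo (suc ∘ suc) (2 * s)) ≡ map g (upTo (2 * s))
  tail = trans (map-applyUpTo (suc ∘ suc) f (2 * s)) (trans
    (applyUpTo-cong (2 * s) (λ i → cong (λ e → 2 ^ e ∸ 1) (sym (ℕ.∸-+-assoc n 1 i))))
    (sym (map-upTo g (2 * s))))

denProd-step : ∀ s → denProd (suc s) ≡ denProd s * (4 * 4 ^ s ∸ 1)
denProd-step s = begin
  denProd (suc s)                             ≡⟨ cong product (map-upTo h (suc s)) ⟩
  product (applyUpTo h (suc s))               ≡⟨ cong product (applyUpTo-∷ʳ h s) ⟨
  product (applyUpTo h s ++ [ h s ])          ≡⟨ product-++ (applyUpTo h s) [ h s ] ⟩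
  product (applyUpTo h s) * (h s * 1)         ≡⟨ cong₂ (λ xs y → product xs * y) (sym (map-upTo h s)) (ℕ.*-identityʳ (h s)) ⟩
  denProd s * h s                             ≡⟨ cong (λ e → denProd s * (e ∸ 1)) (2^[2n]≡4^n (suc s)) ⟩
  denProd s * (4 * 4 ^ s ∸ 1)                 ∎
  where
  open ≡-Reasoning
  h : ℕ → ℕ
  h j = 2 ^ (2 * suc j) ∸ 1

0<denProd : ∀ s → 0 ℕ.< denProd s
0<denProd zero    = z<s
0<denProd (suc s) = subst (0 ℕ.<_) (sym (denProd-step s)) (0<* (0<denProd s) (0<4*4^k∸1 s))

graphWeight : ℕ → ℚ
graphWeight n = 1 /2^ pairs n

summand : ℕ → ℕ → ℚ
summand n s = graphWeight n *ℚ term n s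

0≤summand : ∀ n s → 0ℚ ≤ summand n s
0≤summand n s = subst (0ℚ ≤_) (sym (frac-* (0<2^ (pairs n)) (0<denProd s)))
  (0≤frac (1 * (2 ^ (s * (s + 3)) * numProd n s)) (2 ^ pairs n * denProd s))

r≡Σsummand : ∀ n → r n ≡ Σ (summand n) (n / 2)
r≡Σsummand n = trans (cong (λ xs → graphWeight n *ℚ sumℚ xs) (map-upTo (term n) (n / 2)))
                     (Σ-*ˡ (graphWeight n) (term n) (n / 2))

ratio : ℕ → ℕ → ℚ
ratio a X = frac ((2 * a ∸ 1) * (a ∸ 1) * (16 * X)) (8 * (a * a) * (4 * X ∸ 1))

2^pairs-step : ∀ n → 2 ^ pairs (3 + n) ≡ 2 ^ pairs (1 + n) * (8 * (2 ^ n * 2 ^ n))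
2^pairs-step n = begin
  2 ^ pairs (3 + n)                       ≡⟨ cong (2 ^_) (pairs-+2 (1 + n)) ⟩
  2 ^ (pairs (1 + n) + (2 * suc n + 1))   ≡⟨ ℕ.^-distribˡ-+-* 2 (pairs (1 + n)) (2 * suc n + 1) ⟩
  2 ^ pairs (1 + n) * 2 ^ (2 * suc n + 1) ≡⟨ cong (λ e → 2 ^ pairs (1 + n) * 2 ^ e) (exponent n) ⟩
  2 ^ pairs (1 + n) * 2 ^ (3 + (n + n))   ≡⟨ cong (2 ^ pairs (1 + n) *_) (trans
                                               (ℕ.^-distribˡ-+-* 2 3 (n + n)) (cong (8 *_) (ℕ.^-distribˡ-+-* 2 n n))) ⟩
  2 ^ pairs (1 + n) * (8 * (2 ^ n * 2 ^ n)) ∎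
  where
  open ≡-Reasoning
  exponent : ∀ n → 2 * suc n + 1 ≡ 3 + (n + n)
  exponent = solve-∀

2^[s+1][s+4] : ∀ s → 2 ^ (suc s * (suc s + 3)) ≡ 2 ^ (s * (s + 3)) * (16 * 4 ^ s)
2^[s+1][s+4] s = begin
  2 ^ (suc s * (suc s + 3))             ≡⟨ cong (2 ^_) (exponent s) ⟩
  2 ^ (s * (s + 3) + (4 + 2 * s))       ≡⟨ ℕ.^-distribˡ-+-* 2 (s * (s + 3)) (4 + 2 * s) ⟩
  2 ^ (s * (s + 3)) * 2 ^ (4 + 2 * s)   ≡⟨ cong (2 ^ (s * (s + 3)) *_) (trans
                                             (ℕ.^-distribˡ-+-* 2 4 (2 * s)) (cong (16 *_) (2^[2n]≡4^n s))) ⟩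
  2 ^ (s * (s + 3)) * (16 * 4 ^ s)      ∎
  where
  open ≡-Reasoning
  exponent : ∀ s → suc s * (suc s + 3) ≡ s * (s + 3) + (4 + 2 * s)
  exponent = solve-∀

summand-step : ∀ n s → summand (3 + n) (suc s) ≡ summand (1 + n) s *ℚ ratio (2 ^ n) (4 ^ s)
summand-step n s = begin
  summand (3 + n) (suc s)
    ≡⟨ frac-* (0<2^ (pairs (3 + n))) (0<denProd (suc s)) ⟩
  frac (1 * (2 ^ (suc s * (suc s + 3)) * numProd (3 + n) (suc s))) (2 ^ pairs (3 + n) * denProd (suc s))
    ≡⟨ cong₂ frac (cong₂ (λ e p → 1 * (e * p)) (2^[s+1][s+4] s) (numProd-step n s))
                  (cong₂ _*_ (2^pairs-step n) (denProd-step s)) ⟩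
  frac (1 * (E * Q * (A₁ * (A₂ * P)))) (G * B * (D * W))
    ≡⟨ cong₂ frac (numerator E Q A₁ A₂ P) (denominator G B D W) ⟩
  frac (1 * (E * P) * (A₁ * A₂ * Q)) (G * D * (B * W))
    ≡⟨ frac-* (0<* (0<2^ (pairs (1 + n))) (0<denProd s)) (0<* (0<* {8} z<s (0<* (0<2^ n) (0<2^ n))) (0<4*4^k∸1 s)) ⟨
  frac (1 * (E * P)) (G * D) *ℚ ratio a X
    ≡⟨ cong (_*ℚ ratio a X) (frac-* (0<2^ (pairs (1 + n))) (0<denProd s)) ⟨
  summand (1 + n) s *ℚ ratio a X ∎
  where
  open ≡-Reasoning
  a X E P Q A₁ A₂ G B D W : ℕ
  a = 2 ^ n
  X = 4 ^ s
  E = 2 ^ (s * (s + 3))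
  P = numProd (1 + n) s
  Q = 16 * X
  A₁ = 2 * a ∸ 1
  A₂ = a ∸ 1
  G = 2 ^ pairs (1 + n)
  B = 8 * (a * a)
  D = denProd s
  W = 4 * X ∸ 1
  numerator : ∀ E Q A₁ A₂ P → 1 * (E * Q * (A₁ * (A₂ * P))) ≡ 1 * (E * P) * (A₁ * A₂ * Q)
  numerator = solve-∀
  denominator : ∀ G B D W → G * B * (D * W) ≡ G * D * (B * W)
  denominator = solve-∀

⅓ : ℚ
⅓ = frac 1 3

ratio-suc : ∀ p x → ratio (suc p) (suc x) ≡ frac ((1 + 2 * p) * p * (16 * suc x)) (8 * (suc p * suc p) * (3 + 4 * x))
ratio-suc p x = cong₂ frac (cong (λ u → (u ∸ 1) * p * (16 * suc x)) (ℕ.*-suc 2 p))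
                           (cong (λ u → 8 * (suc p * suc p) * (u ∸ 1)) (ℕ.*-suc 4 x))

ratio-≤ : ∀ {a X} → 0 ℕ.< a → 0 ℕ.< X → ratio a X ≤ 1ℚ +ℚ frac 1 X *ℚ ⅓
ratio-≤ {suc p} {suc x} _ _ = begin
  ratio (suc p) (suc x)                    ≡⟨ ratio-suc p x ⟩
  frac N D                                 ≤⟨ frac-≤ {N} {D} {3X + 1 * 1} {3X} z<s z<s
                                                (ℕ.m+n≤o⇒m≤o _ (ℕ.≤-reflexive (slack p x))) ⟩
  frac (3X + 1 * 1) 3X                     ≡⟨ frac-+ {1} {1} {1} {suc x * 3} z<s z<s ⟨
  1ℚ +ℚ frac 1 (suc x * 3)                 ≡⟨ cong (1ℚ +ℚ_) (frac-* {1} {suc x} {1} {3} z<s z<s) ⟨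
  1ℚ +ℚ frac 1 (suc x) *ℚ ⅓                ∎
  where
  open ℚ.≤-Reasoning
  N D 3X : ℕ
  N = (1 + 2 * p) * p * (16 * suc x)
  D = 8 * (suc p * suc p) * (3 + 4 * x)
  3X = 1 * (suc x * 3)
  slack : ∀ p x → (1 + 2 * p) * p * (16 * suc x) * (1 * (suc x * 3))
                    + 8 * (suc p * suc p * x + 6 * (suc x * suc x) * (2 + 3 * p))
                  ≡ (1 * (suc x * 3) + 1 * 1) * (8 * (suc p * suc p) * (3 + 4 * x))
  slack = solve-∀

ratio-contracts : ∀ {a X} → 0 ℕ.< a → 0 ℕ.< X → ratio a X *ℚ frac 1 (4 * X) ≤ frac 1 X *ℚ ⅓
ratio-contracts {suc p} {suc x} _ _ = begin
  ratio (suc p) (suc x) *ℚ frac 1 (4 * suc x) ≡⟨ cong (_*ℚ frac 1 (4 * suc x)) (ratio-suc p x) ⟩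
  frac N D *ℚ frac 1 (4 * suc x)              ≡⟨ frac-* {N} {D} {1} {4 * suc x} z<s z<s ⟩
  frac (N * 1) (D * (4 * suc x))              ≤⟨ frac-≤ {N * 1} {D * (4 * suc x)} {1 * 1} {suc x * 3} z<s z<s
                                                   (ℕ.m+n≤o⇒m≤o _ (ℕ.≤-reflexive (slack p x))) ⟩
  frac (1 * 1) (suc x * 3)                    ≡⟨ frac-* {1} {suc x} {1} {3} z<s z<s ⟨
  frac 1 (suc x) *ℚ ⅓                         ∎
  where
  open ℚ.≤-Reasoning
  N D : ℕ
  N = (1 + 2 * p) * p * (16 * suc x)
  D = 8 * (suc p * suc p) * (3 + 4 * x)
  slack : ∀ p x → (1 + 2 * p) * p * (16 * suc x) * 1 * (suc x * 3)
                    + 16 * suc x * (2 * (suc p * suc p) * x + 3 * suc x * (2 + 3 * p))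
                  ≡ 1 * 1 * (8 * (suc p * suc p) * (3 + 4 * x) * (4 * suc x))
  slack = solve-∀

ratio-≥ : ∀ {a X} → 0 ℕ.< a → 0 ℕ.< X → 1ℚ ≤ ratio a X +ℚ frac 3 (2 * a)
ratio-≥ {suc p} {suc x} _ _ = begin
  1ℚ                                               ≤⟨ frac-≤ {1} {1} {N * 2a + 3 * D} {D * 2a} z<s z<s
                                                        (ℕ.m+n≤o⇒m≤o _ (ℕ.≤-reflexive (slack p x))) ⟩
  frac (N * 2a + 3 * D) (D * 2a)                   ≡⟨ frac-+ {N} {D} {3} {2a} z<s z<s ⟨
  frac N D +ℚ frac 3 2a                            ≡⟨ cong (_+ℚ frac 3 2a) (ratio-suc p x) ⟨
  ratio (suc p) (suc x) +ℚ frac 3 2a               ∎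
  where
  open ℚ.≤-Reasoning
  N D 2a : ℕ
  N = (1 + 2 * p) * p * (16 * suc x)
  D = 8 * (suc p * suc p) * (3 + 4 * x)
  2a = 2 * suc p
  slack : ∀ p x → 1 * (8 * (suc p * suc p) * (3 + 4 * x) * (2 * suc p))
                    + 8 * suc p * (2 * p * p + p + 3 + 4 * x)
                  ≡ ((1 + 2 * p) * p * (16 * suc x) * (2 * suc p) + 3 * (8 * (suc p * suc p) * (3 + 4 * x))) * 1
  slack = solve-∀

damped : ℕ → ℚ
damped n = Σ (λ s → summand n s *ℚ frac 1 (4 ^ s)) (n / 2)

half-+2 : ∀ m → (2 + m) / 2 ≡ suc (m / 2)
half-+2 m = m/n≡1+[m∸n]/n {2 + m} {2} (s≤s (s≤s z≤n))

r-step : ∀ n → r (3 + n) ≡ graphWeight (3 + n) +ℚ Σ (λ s → summand (1 + n) s *ℚ ratio (2 ^ n) (4 ^ s)) ((1 + n) / 2)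
r-step n = begin
  r (3 + n)                                                  ≡⟨ r≡Σsummand (3 + n) ⟩
  Σ (summand (3 + n)) ((3 + n) / 2)                          ≡⟨ cong (Σ (summand (3 + n))) (half-+2 (1 + n)) ⟩
  summand (3 + n) 0 +ℚ Σ (summand (3 + n) ∘ suc) ((1 + n) / 2)
    ≡⟨ cong₂ _+ℚ_ (ℚ.*-identityʳ (graphWeight (3 + n))) (Σ-cong ((1 + n) / 2) (summand-step n)) ⟩
  graphWeight (3 + n) +ℚ Σ (λ s → summand (1 + n) s *ℚ ratio (2 ^ n) (4 ^ s)) ((1 + n) / 2) ∎
  where open ≡-Reasoning

damped-step : ∀ n → damped (3 + n) ≡ graphWeight (3 + n) +ℚ
  Σ (λ s → summand (1 + n) s *ℚ ratio (2 ^ n) (4 ^ s) *ℚ frac 1 (4 ^ suc s)) ((1 + n) / 2)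
damped-step n = begin
  damped (3 + n)
    ≡⟨ cong (Σ (λ s → summand (3 + n) s *ℚ frac 1 (4 ^ s))) (half-+2 (1 + n)) ⟩
  summand (3 + n) 0 *ℚ 1ℚ +ℚ Σ (λ s → summand (3 + n) (suc s) *ℚ frac 1 (4 ^ suc s)) ((1 + n) / 2)
    ≡⟨ cong₂ _+ℚ_ (trans (ℚ.*-identityʳ (summand (3 + n) 0)) (ℚ.*-identityʳ (graphWeight (3 + n))))
                  (Σ-cong ((1 + n) / 2) (λ s → cong (_*ℚ frac 1 (4 ^ suc s)) (summand-step n s))) ⟩
  graphWeight (3 + n) +ℚ Σ (λ s → summand (1 + n) s *ℚ ratio (2 ^ n) (4 ^ s) *ℚ frac 1 (4 ^ suc s)) ((1 + n) / 2) ∎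
  where open ≡-Reasoning

r-upper-step : ∀ n → r (3 + n) ≤ graphWeight (3 + n) +ℚ (r (1 + n) +ℚ damped (1 + n) *ℚ ⅓)
r-upper-step n = begin
  r (3 + n)                                      ≡⟨ r-step n ⟩
  G +ℚ Σ (λ s → t s *ℚ ρ s) k                    ≤⟨ ℚ.+-monoʳ-≤ G (Σ-mono-≤ k bound) ⟩
  G +ℚ Σ (λ s → t s +ℚ t s *ℚ c s *ℚ ⅓) k        ≡⟨ cong (G +ℚ_) (Σ-+ t (λ s → t s *ℚ c s *ℚ ⅓) k) ⟩
  G +ℚ (Σ t k +ℚ Σ (λ s → t s *ℚ c s *ℚ ⅓) k)    ≡⟨ cong₂ (λ u v → G +ℚ (u +ℚ v)) (r≡Σsummand (1 + n)) (Σ-*ʳ ⅓ _ k) ⟨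
  G +ℚ (r (1 + n) +ℚ damped (1 + n) *ℚ ⅓)        ∎
  where
  open ℚ.≤-Reasoning
  G : ℚ
  G = graphWeight (3 + n)
  k : ℕ
  k = (1 + n) / 2
  t ρ c : ℕ → ℚ
  t = summand (1 + n)
  ρ s = ratio (2 ^ n) (4 ^ s)
  c s = frac 1 (4 ^ s)
  expand : ∀ t c → t *ℚ (1ℚ +ℚ c *ℚ ⅓) ≡ t +ℚ t *ℚ c *ℚ ⅓
  expand = RingSolver.solve-∀ ℚ-ring
  bound : ∀ s → t s *ℚ ρ s ≤ t s +ℚ t s *ℚ c s *ℚ ⅓
  bound s = ℚ.≤-trans (*-monoˡ-≤-0≤ (0≤summand (1 + n) s) (ratio-≤ (0<2^ n) (0<4^ s)))
                      (ℚ.≤-reflexive (expand (t s) (c s)))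

damped-contracts : ∀ n → damped (3 + n) ≤ graphWeight (3 + n) +ℚ damped (1 + n) *ℚ ⅓
damped-contracts n = begin
  damped (3 + n)                                 ≡⟨ damped-step n ⟩
  G +ℚ Σ (λ s → t s *ℚ ρ s *ℚ c (suc s)) k       ≤⟨ ℚ.+-monoʳ-≤ G (Σ-mono-≤ k bound) ⟩
  G +ℚ Σ (λ s → t s *ℚ c s *ℚ ⅓) k               ≡⟨ cong (G +ℚ_) (Σ-*ʳ ⅓ _ k) ⟨
  G +ℚ damped (1 + n) *ℚ ⅓                       ∎
  where
  open ℚ.≤-Reasoning
  G : ℚ
  G = graphWeight (3 + n)
  k : ℕ
  k = (1 + n) / 2
  t ρ c : ℕ → ℚ
  t = summand (1 + n)
  ρ s = ratio (2 ^ n) (4 ^ s)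
  c s = frac 1 (4 ^ s)
  bound : ∀ s → t s *ℚ ρ s *ℚ c (suc s) ≤ t s *ℚ c s *ℚ ⅓
  bound s = begin
    t s *ℚ ρ s *ℚ c (suc s)     ≡⟨ ℚ.*-assoc (t s) _ _ ⟩
    t s *ℚ (ρ s *ℚ c (suc s))   ≤⟨ *-monoˡ-≤-0≤ (0≤summand (1 + n) s) (ratio-contracts (0<2^ n) (0<4^ s)) ⟩
    t s *ℚ (c s *ℚ ⅓)           ≡⟨ ℚ.*-assoc (t s) _ _ ⟨
    t s *ℚ c s *ℚ ⅓             ∎

r-lower-step : ∀ n → r (1 + n) ≤ r (3 + n) +ℚ 3 /2^ suc n *ℚ r (1 + n)
r-lower-step n = begin
  r (1 + n)                              ≡⟨ r≡Σsummand (1 + n) ⟩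
  Σ t k                                  ≤⟨ Σ-mono-≤ k bound ⟩
  Σ (λ s → t s *ℚ ρ s +ℚ ε *ℚ t s) k     ≡⟨ Σ-+ (λ s → t s *ℚ ρ s) (λ s → ε *ℚ t s) k ⟩
  S +ℚ Σ (λ s → ε *ℚ t s) k              ≡⟨ cong (S +ℚ_) (Σ-*ˡ ε t k) ⟨
  S +ℚ ε *ℚ Σ t k                        ≤⟨ ℚ.+-monoˡ-≤ (ε *ℚ Σ t k) S≤G+S ⟩
  graphWeight (3 + n) +ℚ S +ℚ ε *ℚ Σ t k ≡⟨ cong₂ (λ u v → u +ℚ ε *ℚ v) (r-step n) (r≡Σsummand (1 + n)) ⟨
  r (3 + n) +ℚ ε *ℚ r (1 + n)            ∎
  where
  open ℚ.≤-Reasoning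
  k : ℕ
  k = (1 + n) / 2
  ε S : ℚ
  ε = 3 /2^ suc n
  S = Σ (λ s → summand (1 + n) s *ℚ ratio (2 ^ n) (4 ^ s)) k
  t ρ : ℕ → ℚ
  t = summand (1 + n)
  ρ s = ratio (2 ^ n) (4 ^ s)
  S≤G+S : S ≤ graphWeight (3 + n) +ℚ S
  S≤G+S = subst (S ≤_) (ℚ.+-comm S _) (p≤p+q S (0≤frac 1 (2 ^ pairs (3 + n))))
  expand : ∀ t ρ ε → t *ℚ (ρ +ℚ ε) ≡ t *ℚ ρ +ℚ ε *ℚ t
  expand = RingSolver.solve-∀ ℚ-ring
  bound : ∀ s → t s ≤ t s *ℚ ρ s +ℚ ε *ℚ t s
  bound s = begin
    t s                       ≡⟨ ℚ.*-identityʳ (t s) ⟨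
    t s *ℚ 1ℚ                 ≤⟨ *-monoˡ-≤-0≤ (0≤summand (1 + n) s) (ratio-≥ (0<2^ n) (0<4^ s)) ⟩
    t s *ℚ (ρ s +ℚ ε)         ≡⟨ expand (t s) (ρ s) ε ⟩
    t s *ℚ ρ s +ℚ ε *ℚ t s    ∎

3+n≤pairs[3+n] : ∀ n → 3 + n ℕ.≤ pairs (3 + n)
3+n≤pairs[3+n] n = subst (3 + n ℕ.≤_) (sym (pairs-+2 (1 + n)))
  (ℕ.≤-trans (ℕ.m+n≤o⇒m≤o (3 + n) (ℕ.≤-reflexive (slack n))) (ℕ.m≤n+m _ (pairs (1 + n))))
  where
  slack : ∀ n → 3 + n + n ≡ 2 * suc n + 1
  slack = solve-∀

sixteenth+third≤half : ∀ j → 1 /2^ (4 + j) +ℚ 1 /2^ j *ℚ ⅓ ≤ 1 /2^ suc j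
sixteenth+third≤half j = begin
  1 /2^ (4 + j) +ℚ 1 /2^ j *ℚ ⅓            ≡⟨ cong (1 /2^ (4 + j) +ℚ_) (frac-* (0<2^ j) z<s) ⟩
  1 /2^ (4 + j) +ℚ frac 1 (2 ^ j * 3)      ≡⟨ frac-+ (0<2^ (4 + j)) (0<* (0<2^ j) z<s) ⟩
  frac (1 * (2 ^ j * 3) + 1 * 2 ^ (4 + j)) (2 ^ (4 + j) * (2 ^ j * 3))
                                           ≤⟨ frac-≤ (0<* (0<2^ (4 + j)) (0<* (0<2^ j) z<s)) (0<2^ (suc j))
                                                (ℕ.m+n≤o⇒m≤o _ (ℕ.≤-reflexive (slack (2 ^ j)))) ⟩
  1 /2^ suc j                              ∎
  where
  open ℚ.≤-Reasoning
  slack : ∀ y → (1 * (y * 3) + 1 * (2 * (2 * (2 * (2 * y))))) * (2 * y) + 10 * (y * y)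
              ≡ 1 * (2 * (2 * (2 * (2 * y))) * (y * 3))
  slack = solve-∀

-- Parity subsequences

-- e + 2 * j by recursion on j, so that consecutive terms r (2 + (e +2* j)) and r (2 + (e +2* suc j))
-- are definitionally r (1 + n) and r (3 + n) for n = 1 + (e +2* j).
_+2*_ : ℕ → ℕ → ℕ
e +2* zero  = e
e +2* suc j = suc (suc (e +2* j))

+2*≡ : ∀ e j → e +2* j ≡ 2 * j + e
+2*≡ e zero    = refl
+2*≡ e (suc j) = trans (cong (2 +_) (+2*≡ e j)) (cong (_+ e) (sym (ℕ.*-suc 2 j)))

j≤e+2*j : ∀ e j → j ℕ.≤ e +2* j
j≤e+2*j e zero    = z≤n
j≤e+2*j e (suc j) = s≤s (ℕ.m≤n⇒m≤1+n (j≤e+2*j e j))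

module ParitySubsequence (e : ℕ) (r≤1 : r (2 + e) ≤ 1ℚ) (damped≤1 : damped (2 + e) ≤ 1ℚ) where

  R V : ℕ → ℚ
  R j = r (2 + (e +2* j))
  V j = damped (2 + (e +2* j))

  perturbation-≤ : ∀ j → V j ≤ 1 /2^ j → graphWeight (4 + (e +2* j)) +ℚ V j *ℚ ⅓ ≤ 1 /2^ suc j
  perturbation-≤ j V≤ = ℚ.≤-trans
    (ℚ.+-mono-≤ (ℚ.≤-trans (/2^-antitone 1 (3+n≤pairs[3+n] (1 + (e +2* j))))
                           (/2^-antitone 1 (s≤s (s≤s (s≤s (s≤s (j≤e+2*j e j)))))))
                (ℚ.*-monoʳ-≤-nonNeg ⅓ V≤))
    (sixteenth+third≤half j)

  V-≤ : ∀ j → V j ≤ 1 /2^ j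
  V-≤ zero    = damped≤1
  V-≤ (suc j) = ℚ.≤-trans (damped-contracts (1 + (e +2* j))) (perturbation-≤ j (V-≤ j))

  R-up : ∀ j → R (suc j) ≤ R j +ℚ 1 /2^ suc j
  R-up j = begin
    R (suc j)                   ≤⟨ r-upper-step (1 + (e +2* j)) ⟩
    G +ℚ (R j +ℚ V j *ℚ ⅓)      ≡⟨ swap G (R j) (V j *ℚ ⅓) ⟩
    R j +ℚ (G +ℚ V j *ℚ ⅓)      ≤⟨ ℚ.+-monoʳ-≤ (R j) (perturbation-≤ j (V-≤ j)) ⟩
    R j +ℚ 1 /2^ suc j          ∎
    where
    open ℚ.≤-Reasoning
    G : ℚ
    G = graphWeight (4 + (e +2* j))
    swap : ∀ g r w → g +ℚ (r +ℚ w) ≡ r +ℚ (g +ℚ w)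
    swap = RingSolver.solve-∀ ℚ-ring

  R≤2 : ∀ j → R j ≤ 1ℚ +ℚ 1ℚ
  R≤2 j = ℚ.≤-trans (upper-drift {R} 1 R-up {0} {j} z≤n) (ℚ.+-monoˡ-≤ 1ℚ r≤1)

  R-down : ∀ j → R j ≤ R (suc j) +ℚ 3 /2^ suc j
  R-down j = begin
    R j                                  ≤⟨ r-lower-step n ⟩
    R (suc j) +ℚ ε *ℚ R j                ≤⟨ ℚ.+-monoʳ-≤ (R (suc j)) (*-monoˡ-≤-0≤ (0≤frac 3 (2 ^ suc n)) (R≤2 j)) ⟩
    R (suc j) +ℚ ε *ℚ (1ℚ +ℚ 1ℚ)         ≡⟨ cong (R (suc j) +ℚ_) double ⟩
    R (suc j) +ℚ 3 /2^ n                 ≤⟨ ℚ.+-monoʳ-≤ (R (suc j)) (/2^-antitone 3 (s≤s (j≤e+2*j e j))) ⟩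
    R (suc j) +ℚ 3 /2^ suc j             ∎
    where
    open ℚ.≤-Reasoning
    n : ℕ
    n = 1 + (e +2* j)
    ε : ℚ
    ε = 3 /2^ suc n
    double : ε *ℚ (1ℚ +ℚ 1ℚ) ≡ 3 /2^ n
    double = trans (trans (ℚ.*-distribˡ-+ ε 1ℚ 1ℚ) (cong₂ _+ℚ_ (ℚ.*-identityʳ ε) (ℚ.*-identityʳ ε))) (/2^-halve 3 n)

  R-Cauchy : Cauchy R
  R-Cauchy = nearlyMonotone⇒Cauchy 1 3 R-up R-down

  R-boundedAway : 3 /2^ 5 < R 5 → BoundedAwayFromZero R
  R-boundedAway = lower-drift⇒BoundedAwayFromZero 3 5 R-down

mainTheorem2 : ((∀ (ε : ℚ) → 0ℚ < ε → ∃[ N ] (∀ m k → m ≥ N → k ≥ N → ∣ r (2 * m) - r (2 * k) ∣ < ε))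
                 × (∃[ c ] (0ℚ < c × ∃[ N ] (∀ m → m ≥ N → c ≤ r (2 * m)))))
               × ((∀ (ε : ℚ) → 0ℚ < ε → ∃[ N ] (∀ m k → m ≥ N → k ≥ N → ∣ r (2 * m + 1) - r (2 * k + 1) ∣ < ε))
                 × (∃[ c ] (0ℚ < c × ∃[ N ] (∀ m → m ≥ N → c ≤ r (2 * m + 1)))))
mainTheorem2 =
  ( Cauchy-tail {λ m → r (2 * m)} even Even.R-Cauchy
  , BoundedAwayFromZero-tail {λ m → r (2 * m)} even (Even.R-boundedAway (from-yes (3 /2^ 5 ℚ.<? Even.R 5))) ) ,
  ( Cauchy-tail {λ m → r (2 * m + 1)} odd Odd.R-Cauchy
  , BoundedAwayFromZero-tail {λ m → r (2 * m + 1)} odd (Odd.R-boundedAway (from-yes (3 /2^ 5 ℚ.<? Odd.R 5))) )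
  where
  module Even = ParitySubsequence 0 (from-yes (r 2 ℚ.≤? 1ℚ)) (from-yes (damped 2 ℚ.≤? 1ℚ))
  module Odd  = ParitySubsequence 1 (from-yes (r 3 ℚ.≤? 1ℚ)) (from-yes (damped 3 ℚ.≤? 1ℚ))
  even : ∀ j → r (2 * suc j) ≡ Even.R j
  even j = cong r (trans (sym (ℕ.+-identityʳ (2 * suc j))) (sym (+2*≡ 0 (suc j))))
  odd : ∀ j → r (2 * suc j + 1) ≡ Odd.R j
  odd j = cong r (sym (+2*≡ 1 (suc j)))
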